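{- Let $\Sigma$ be a (finite or infinite) totally ordered alphabet, and let $LS \subseteq \Sigma^{*}$ be a set of words with $\varepsilon \in LS$. Call a word $w \in LS$ an orphan path if some prefix of $w$ does not belong to $LS$, and a non-orphan path otherwise. Let $LT$ be the set obtained as follows: first put every non-orphan path of $LS$ into $LT$; then, for every orphan path $w = a_1 a_2 \cdots a_n \in LS$ (with $a_i \in \Sigma$), processed in order of increasing length and, among words of equal length, in the order induced by $\Sigma$, apply one fixed policy among the following four (the same policy for all orphan paths): \begin{itemize} \item skip: add nothing to $LT$ for $w$; \item reappear: add to $LT$ all prefixes $a_1 \cdots a_j$ for $j \in [1,n]$; \item root: add to $LT$ the word $a_j \cdots a_n$, where $j$ is the index such that $a_1 \cdots a_{j-1} \notin LS$ and $a_1 \cdots a_k \in LS$ for all $k \in [j,n]$; \item compact: add to $LT$ the word $a_1 \cdots a_m a_j \cdots a_n$, where $j$ is as in the root policy and $m < j$ is such that $a_1 \cdots a_m$ is a non-orphan path (hence in $LT$) and $a_1 \cdots a_{m+1} \notin LS$. \end{itemize} Then, for each of the four policies: (i) $LT$ is a word tree, i.e. $\varepsilon \in LT$ and for all $p, e \in \Sigma^{*}$, $pe \in LT$ implies $p \in LT$; and (ii) $LT$ is eventually consistent: $LT$ is determined by $LS$ (and the chosen policy), so if the lookup sets $LS$ held by the replicas eventually coincide, the computed sets $LT$ eventually coincide as well.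
   Context: Setting: a replicated tree is represented as a "word tree", i.e. the set of all its root-to-node paths, each path being a word over the alphabet $\Sigma$; the empty word $\varepsilon$ represents the root. $\Sigma^{*}$ denotes the set of finite words over $\Sigma$. Paths are stored in an eventually consistent replicated set (a set CRDT); $LS$ denotes the set of paths currently visible in that replicated set (its "lookup"). Because of concurrent additions of a path and removals of one of its prefixes, $LS$ need not be prefix-closed, so a tree $LT$ is computed from $LS$ by one of the listed "connection policies". Eventual consistency means that replicas which have received the same updates end up with identical values; the underlying set CRDT guarantees that $LS$ is eventually consistent. -}

module Defs where

open import Data.List using (List; []; _∷_; _++_; [_])
open import Data.Product using (Σ; ∃; ∃-syntax; _×_; _,_)
open import Data.Sum using (_⊎_)
open import Data.Empty using (⊥)
open import Relation.Nullary using (¬_)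
open import Relation.Binary.PropositionalEquality using (_≡_; _≢_)

WordSet : Set → Set₁
WordSet A = List A → Set

module _ {A : Set} where

  IsWordTree : WordSet A → Set
  IsWordTree T = T [] × (∀ (p e : List A) → T (p ++ e) → T p)

  NonOrphan : WordSet A → List A → Set
  NonOrphan LS w = LS w × (∀ (p e : List A) → p ++ e ≡ w → LS p)

  Orphan : WordSet A → List A → Set
  Orphan LS w = LS w × (∃[ p ] ∃[ e ] (p ++ e ≡ w × ¬ LS p))

  -- w = u ++ v where u = a₁…a_{j-1} ∉ LS and a₁…a_k ∈ LS for all k ∈ [j,n],
  -- i.e. u ++ x ∈ LS for every nonempty prefix x of v.
  RootSplit : WordSet A → List A → List A → List A → Set
  RootSplit LS w u v =
    u ++ v ≡ w × ¬ LS u × (∀ (x y : List A) → x ++ y ≡ v → x ≢ [] → LS (u ++ x))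

data Policy : Set where
  skip reappear root compact : Policy

module _ {A : Set} where

  Adds : Policy → WordSet A → List A → List A → Set
  Adds skip     LS w v = ⊥
  Adds reappear LS w v = (∃[ e ] v ++ e ≡ w) × v ≢ []
  Adds root     LS w v = ∃[ u ] RootSplit LS w u v
  Adds compact  LS w v =
    ∃[ u ] ∃[ s ] ∃[ p ] ∃[ a ] ∃[ r ]
      ( RootSplit LS w u s
      × p ++ (a ∷ r) ≡ w
      × NonOrphan LS p
      × ¬ LS (p ++ [ a ])
      × (∃[ q ] p ++ q ≡ u)
      × v ≡ p ++ s )

  -- LT: all non-orphan paths, plus what each orphan path contributes.
  -- (Contributions only add words, so the processing order does not affect LT.)
  LT : Policy → WordSet A → WordSet A
  LT pol LS v = NonOrphan LS v ⊎ (∃[ w ] (Orphan LS w × Adds pol LS w v))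

-- Prefixes of non-orphan paths are non-orphan. For an orphan path w = u ++ s split as in the
-- root policy, every nonempty prefix u ++ s′ of w is again an orphan path with the same split
-- point u, and it contributes exactly the corresponding prefix (s′ under root, p ++ s′ under
-- compact); under reappear the contributions of w are already closed under prefixes.
-- Eventual consistency holds because LT mentions LS only through membership.
module Submission where

open import Defs
open import Data.List using (List; []; _∷_; _++_; [_])
open import Data.List.Properties using (++-assoc; ++-identityʳ; ++-cancelˡ; ∷-injectiveˡ; ∷-injectiveʳ)
open import Data.Product using (_×_; _,_; ∃-syntax; proj₁; proj₂)
open import Data.Sum using (_⊎_; inj₁; inj₂)
open import Data.Empty using (⊥-elim)
open import Relation.Nullary using (¬_)
open import Function.Bundles using (_⇔_; mk⇔; Equivalence)
import Function.Properties.Equivalence as ⇔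
open import Relation.Binary.Bundles using (StrictTotalOrder)
open import Relation.Binary.PropositionalEquality using (_≡_; _≢_; refl; sym; trans; cong; subst)
open import Level using (0ℓ)

module _ {A : Set} where

  prefix-of-++ : ∀ (p e x y : List A) → p ++ e ≡ x ++ y →
                 (∃[ t ] p ++ t ≡ x) ⊎ (∃[ s ] p ≡ x ++ s × s ++ e ≡ y)
  prefix-of-++ []      e x       y eq = inj₁ (x , refl)
  prefix-of-++ (c ∷ p) e []      y eq = inj₂ (c ∷ p , refl , eq)
  prefix-of-++ (c ∷ p) e (d ∷ x) y eq with refl ← ∷-injectiveˡ eq
                                         | prefix-of-++ p e x y (∷-injectiveʳ eq)
  ... | inj₁ (t , p++t≡x)           = inj₁ (t , cong (c ∷_) p++t≡x)
  ... | inj₂ (s , p≡x++s , s++e≡y) = inj₂ (s , cong (c ∷_) p≡x++s , s++e≡y)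

  prefix-trans : ∀ (x y e : List A) {z w} → x ++ y ≡ z → z ++ e ≡ w → x ++ (y ++ e) ≡ w
  prefix-trans x y e refl z++e≡w = trans (sym (++-assoc x y e)) z++e≡w

  ++-∷-cancelˡ : ∀ (p : List A) {a b r s} → p ++ a ∷ r ≡ p ++ b ∷ s → a ≡ b
  ++-∷-cancelˡ p eq = ∷-injectiveˡ (++-cancelˡ p _ _ eq)

  module _ {LS LS′ : WordSet A} (LS⇔LS′ : ∀ w → LS w ⇔ LS′ w) where

    private
      to : ∀ w → LS w → LS′ w
      to w = Equivalence.to (LS⇔LS′ w)

      from : ∀ w → LS′ w → LS w
      from w = Equivalence.from (LS⇔LS′ w)

    NonOrphan-resp : ∀ v → NonOrphan LS v → NonOrphan LS′ v
    NonOrphan-resp v (v∈LS , prefixes∈LS) = to v v∈LS , λ p e eq → to p (prefixes∈LS p e eq)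

    Orphan-resp : ∀ v → Orphan LS v → Orphan LS′ v
    Orphan-resp v (v∈LS , p , e , eq , p∉LS) = to v v∈LS , p , e , eq , λ p∈LS′ → p∉LS (from p p∈LS′)

    RootSplit-resp : ∀ w u v → RootSplit LS w u v → RootSplit LS′ w u v
    RootSplit-resp w u v (eq , u∉LS , h) =
      eq , (λ u∈LS′ → u∉LS (from u u∈LS′)) , λ x y eq′ x≢[] → to (u ++ x) (h x y eq′ x≢[])

    Adds-resp : ∀ pol w v → Adds pol LS w v → Adds pol LS′ w v
    Adds-resp reappear w v added = added
    Adds-resp root     w v (u , split) = u , RootSplit-resp w u v split
    Adds-resp compact  w v (u , s , p , a , r , split , eq , p-nonOrphan , pa∉LS , u-ext , v≡p++s) =
      u , s , p , a , r , RootSplit-resp w u s split , eq , NonOrphan-resp p p-nonOrphan ,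
      (λ pa∈LS′ → pa∉LS (from (p ++ [ a ]) pa∈LS′)) , u-ext , v≡p++s

    LT-resp : ∀ pol v → LT pol LS v → LT pol LS′ v
    LT-resp pol v (inj₁ v-nonOrphan)     = inj₁ (NonOrphan-resp v v-nonOrphan)
    LT-resp pol v (inj₂ (w , o , added)) = inj₂ (w , Orphan-resp w o , Adds-resp pol w v added)

  LT-cong : ∀ pol {LS LS′ : WordSet A} → (∀ w → LS w ⇔ LS′ w) → ∀ v → LT pol LS v ⇔ LT pol LS′ v
  LT-cong pol LS⇔LS′ v =
    mk⇔ (LT-resp LS⇔LS′ pol v) (LT-resp (λ w → ⇔.sym (LS⇔LS′ w)) pol v)

  module _ (LS : WordSet A) where

    nonOrphan-ε : LS [] → NonOrphan LS []
    nonOrphan-ε ε∈LS = ε∈LS , λ { [] e eq → ε∈LS ; (_ ∷ _) e () }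

    nonOrphan-prefix : ∀ p e {v} → p ++ e ≡ v → NonOrphan LS v → NonOrphan LS p
    nonOrphan-prefix p e p++e≡v (_ , prefixes∈LS) =
      prefixes∈LS p e p++e≡v ,
      λ p′ e′ p′++e′≡p → prefixes∈LS p′ (e′ ++ e) (prefix-trans p′ e′ e p′++e′≡p p++e≡v)

    rootSplit-prefix : ∀ {w u s} s′ e → RootSplit LS w u s → s′ ++ e ≡ s → s′ ≢ [] →
                       Orphan LS (u ++ s′) × RootSplit LS (u ++ s′) u s′
    rootSplit-prefix {u = u} s′ e (_ , u∉LS , h) s′++e≡s s′≢[] =
      (h s′ e s′++e≡s s′≢[] , u , s′ , refl , u∉LS) ,
      refl , u∉LS , λ x y x++y≡s′ x≢[] → h x (y ++ e) (prefix-trans x y e x++y≡s′ s′++e≡s) x≢[]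

    reappear-prefix : LS [] → ∀ {w} p e → Orphan LS w → Adds reappear LS w (p ++ e) → LT reappear LS p
    reappear-prefix ε∈LS []      e o added           = inj₁ (nonOrphan-ε ε∈LS)
    reappear-prefix _    (c ∷ p) e o ((e′ , eq) , _) =
      inj₂ (_ , o , (e ++ e′ , prefix-trans (c ∷ p) e e′ refl eq) , λ ())

    root-prefix : LS [] → ∀ {w} p e → Adds root LS w (p ++ e) → LT root LS p
    root-prefix ε∈LS []      e added       = inj₁ (nonOrphan-ε ε∈LS)
    root-prefix _    (c ∷ p) e (u , split) =
      let (o , split′) = rootSplit-prefix (c ∷ p) e split refl (λ ()) in
      inj₂ (u ++ c ∷ p , o , u , split′)

    -- q ≢ [] because u ∉ LS whereas p₀ ∈ LS; its first letter is then the letter a that leaves LS.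
    compact-prefix : ∀ {w} p e → Adds compact LS w (p ++ e) → LT compact LS p
    compact-prefix p e (u , s , p₀ , a , r , split@(u++s≡w , u∉LS , _) , p₀ar≡w ,
                        p₀-nonOrphan , p₀a∉LS , (q , p₀q≡u) , p++e≡p₀s)
      with prefix-of-++ p e p₀ s p++e≡p₀s | q
    ... | inj₁ (t , p++t≡p₀) | _ = inj₁ (nonOrphan-prefix p t p++t≡p₀ p₀-nonOrphan)
    ... | inj₂ ([] , p≡p₀[] , _) | _ =
      inj₁ (subst (NonOrphan LS) (sym (trans p≡p₀[] (++-identityʳ p₀))) p₀-nonOrphan)
    ... | inj₂ (c ∷ s′ , _ , _) | [] =
      ⊥-elim (u∉LS (subst LS (trans (sym (++-identityʳ p₀)) p₀q≡u) (proj₁ p₀-nonOrphan)))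
    ... | inj₂ (c ∷ s′ , p≡p₀cs′ , cs′e≡s) | b ∷ q′ =
      inj₂ (u ++ c ∷ s′ , o , u , c ∷ s′ , p₀ , b , q′ ++ c ∷ s′ , split′ ,
            prefix-trans p₀ (b ∷ q′) (c ∷ s′) p₀q≡u refl ,
            p₀-nonOrphan , subst (λ x → ¬ LS (p₀ ++ [ x ])) (sym b≡a) p₀a∉LS , (b ∷ q′ , p₀q≡u) , p≡p₀cs′)
      where
        o×split′ : Orphan LS (u ++ c ∷ s′) × RootSplit LS (u ++ c ∷ s′) u (c ∷ s′)
        o×split′ = rootSplit-prefix (c ∷ s′) e split cs′e≡s (λ ())

        o : Orphan LS (u ++ c ∷ s′)
        o = proj₁ o×split′

        split′ : RootSplit LS (u ++ c ∷ s′) u (c ∷ s′)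
        split′ = proj₂ o×split′

        b≡a : b ≡ a
        b≡a = ++-∷-cancelˡ p₀ (trans (prefix-trans p₀ (b ∷ q′) s p₀q≡u u++s≡w) (sym p₀ar≡w))

    LT-prefix-closed : LS [] → ∀ pol p e → LT pol LS (p ++ e) → LT pol LS p
    LT-prefix-closed _    pol      p e (inj₁ pe-nonOrphan)    = inj₁ (nonOrphan-prefix p e refl pe-nonOrphan)
    LT-prefix-closed ε∈LS reappear p e (inj₂ (_ , o , added)) = reappear-prefix ε∈LS p e o added
    LT-prefix-closed ε∈LS root     p e (inj₂ (_ , _ , added)) = root-prefix ε∈LS p e added
    LT-prefix-closed _    compact  p e (inj₂ (_ , _ , added)) = compact-prefix p e added

    LT-isWordTree : LS [] → ∀ pol → IsWordTree (LT pol LS)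
    LT-isWordTree ε∈LS pol = inj₁ (nonOrphan-ε ε∈LS) , LT-prefix-closed ε∈LS pol

mainTheorem1 : (O : StrictTotalOrder 0ℓ 0ℓ 0ℓ) →
    let A = StrictTotalOrder.Carrier O in
    (LS : WordSet A) → LS [] → (pol : Policy) →
    IsWordTree (LT pol LS)
    × ((LS′ : WordSet A) → (∀ w → LS w ⇔ LS′ w) → ∀ v → LT pol LS v ⇔ LT pol LS′ v)
mainTheorem1 _ LS ε∈LS pol = LT-isWordTree LS ε∈LS pol , λ _ LS⇔LS′ → LT-cong pol LS⇔LS′
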